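{- Let $\ell$ be an odd prime, let $z$ be a primitive $\ell$-th root of unity over $\mathbb{Q}$, let $R$ and $R'$ be the sets of quadratic residues and quadratic nonresidues modulo $\ell$ in $\{1,\ldots,\ell-1\}$, and factor $x^{\ell}-1=(x-1)f(x)g(x)$ with \[ f(x)=\prod_{r\in R}(x-z^r),\qquad g(x)=\prod_{s\in R'}(x-z^s). \] Let $\eta:=\sum_{r\in R}z^r$ and $\eta':=\sum_{s\in R'}z^s$, and let $L:=\mathbb{Q}(\eta)$ (so $f,g\in L[x]$). Let $A^+$ be the cyclic code of length $\ell$ over $L$ generated by $f(x)$. Let $\gamma\in L$ satisfy $\ell\gamma^2=\left(\frac{ -1}{\ell}\right)$, and let \[ A_\infty:=\{(a_0,\ldots,a_{\ell-1};a_\infty): (a_0,\ldots,a_{\ell-1})\in A^+,\ a_\infty=\gamma\textstyle\sum_{i}a_i\}\subseteq L^{\ell+1}. \] Let $\sigma$ be the monomial transformation of $L^{\ell+1}$ (coordinates indexed by $0,1,\ldots,\ell-1,\infty$) given by \[ (a_0,\ldots,a_i,\ldots;a_\infty)\sigma:=(\epsilon_0a_\infty,\ldots,\epsilon_i a_{ -1/i},\ldots;\epsilon_\infty a_0), \] where for $0<i<\ell$ the index $-1/i$ is computed modulo $\ell$, $\epsilon_i=\left(\frac{i}{\ell}\right)$ (Legendre symbol), $\epsilon_0=1$ and $\epsilon_\infty=\left(\frac{ -1}{\ell}\right)$. If $A_\infty\sigma\subseteq A_\infty$, then \[ \ell\gamma=-(\eta-\eta'). \]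
   Context: Codewords of length $\ell$ are identified with polynomials of degree less than $\ell$ (the $n$-tuple $(a_0,\ldots,a_{\ell-1})$ corresponds to $\sum a_ix^i$), and the cyclic code generated by $f(x)$ is the set of polynomials of degree $<\ell$ over $L$ that are multiples of $f(x)$ modulo $x^\ell-1$. The quantity $\eta$ is (minus) the coefficient of $x^{(\ell-1)/2-1}$ in $f(x)$, and $1+\eta+\eta'=0$. -}

module Defs where

open import Level using (Level; _⊔_) renaming (suc to lsuc)
open import Data.Nat using (ℕ; zero; suc; NonZero)
import Data.Nat as N
open N using (_≡ᵇ_; _∸_; _%_)
open import Data.Bool using (Bool; true; false; if_then_else_; _∧_)
open import Data.List using (List; []; _∷_; foldr)
open import Data.Fin using (Fin; toℕ; fromℕ<)
import Data.Product
open import Data.Nat.DivMod using (m%n<n)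
open import Data.Product using (Σ; _×_; ∃)
open import Relation.Nullary using (¬_)
open import Algebra.Bundles using (CommutativeRing)

record Field (c ℓ : Level) : Set (lsuc (c ⊔ ℓ)) where
  field
    commutativeRing : CommutativeRing c ℓ
  open CommutativeRing commutativeRing public
  field
    1≉0     : ¬ (1# ≈ 0#)
    inverse : ∀ x → ¬ (x ≈ 0#) → Σ Carrier λ y → x * y ≈ 1#

anyBelow : ℕ → (ℕ → Bool) → Bool
anyBelow zero    P = false
anyBelow (suc n) P = if P n then true else anyBelow n P

isQR : (l r : ℕ) → Bool
isQR zero    r = false
isQR (suc k) r =
  if r % suc k ≡ᵇ 0 then false
  else anyBelow (suc k) (λ x → (x N.* x) % suc k ≡ᵇ r % suc k)

-- first j < n with P j, default 0
findBelow : ℕ → (ℕ → Bool) → ℕ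
findBelow zero    P = 0
findBelow (suc n) P = go (suc n) 0
  where
  go : ℕ → ℕ → ℕ
  go zero    j = 0
  go (suc m) j = if P j then j else go m (suc j)

-- the residue -1/i modulo l : the j in {0,…,l-1} with i*j ≡ -1 (mod l)
negInv : (l : ℕ) → .{{_ : NonZero l}} → ℕ → ℕ
negInv l i = findBelow l (λ j → (i N.* j N.+ 1) % l ≡ᵇ 0)

module _ {c ℓ : Level} (F : Field c ℓ) where
  open Field F

  ι : ℕ → Carrier
  ι zero    = 0#
  ι (suc n) = 1# + ι n

  pow : Carrier → ℕ → Carrier
  pow x zero    = 1#
  pow x (suc n) = x * pow x n

  sumBelow : ℕ → (ℕ → Carrier) → Carrier
  sumBelow zero    g = 0#
  sumBelow (suc n) g = sumBelow n g + g n

  sumFin : (n : ℕ) → (Fin n → Carrier) → Carrier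
  sumFin zero    g = 0#
  sumFin (suc n) g = g Data.Fin.zero + sumFin n (λ i → g (Data.Fin.suc i))

  -- Legendre symbol (i / l) as an element of F, for i ≢ 0 mod l
  legendre : (l i : ℕ) → Carrier
  legendre l i = if isQR l i then 1# else - 1#

  -- polynomials as coefficient lists, lowest degree first
  Poly : Set c
  Poly = List Carrier

  addP : Poly → Poly → Poly
  addP []       q        = q
  addP (a ∷ p)  []       = a ∷ p
  addP (a ∷ p)  (b ∷ q)  = (a + b) ∷ addP p q

  scaleP : Carrier → Poly → Poly
  scaleP a []      = []
  scaleP a (b ∷ p) = (a * b) ∷ scaleP a p

  mulXminus : Carrier → Poly → Poly
  mulXminus a p = addP (0# ∷ p) (scaleP (- a) p)

  prodRoots : Carrier → ℕ → (ℕ → Bool) → Poly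
  prodRoots w zero    P = 1# ∷ []
  prodRoots w (suc n) P =
    if P n then mulXminus (pow w n) (prodRoots w n P) else prodRoots w n P

  coeff : Poly → ℕ → Carrier
  coeff []      i       = 0#
  coeff (a ∷ p) zero    = a
  coeff (a ∷ p) (suc i) = coeff p i

  inR : ℕ → ℕ → Bool
  inR l r = isQR l r

  inR' : ℕ → ℕ → Bool
  inR' l s = if s ≡ᵇ 0 then false else (if isQR l s then false else true)

  fPoly : (l : ℕ) → Carrier → Poly
  fPoly l z = prodRoots z l (inR l)

  η : (l : ℕ) → Carrier → Carrier
  η l z = sumBelow l (λ r → if inR l r then pow z r else 0#)

  η' : (l : ℕ) → Carrier → Carrier
  η' l z = sumBelow l (λ s → if inR' l s then pow z s else 0#)

  -- the subfield ℚ(e) of F: the smallest subset containing 1 and e and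
  -- closed under +, -, *, inverses of nonzero elements (and ≈)
  data InSubfield (e : Carrier) : Carrier → Set (c ⊔ ℓ) where
    sf-one  : InSubfield e 1#
    sf-gen  : InSubfield e e
    sf-add  : ∀ {x y} → InSubfield e x → InSubfield e y → InSubfield e (x + y)
    sf-neg  : ∀ {x} → InSubfield e x → InSubfield e (- x)
    sf-mul  : ∀ {x y} → InSubfield e x → InSubfield e y → InSubfield e (x * y)
    sf-inv  : ∀ {x y} → InSubfield e x → x * y ≈ 1# → InSubfield e y
    sf-resp : ∀ {x y} → x ≈ y → InSubfield e x → InSubfield e y

  subMod : (l : ℕ) → .{{_ : NonZero l}} → Fin l → Fin l → ℕ
  subMod l i j = (l N.+ toℕ i ∸ toℕ j) % l

  -- A⁺ : words (a_0,…,a_{l-1}) ∈ L^l with Σ a_i x^i ≡ h(x) f(x) mod x^l - 1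
  -- for some h ∈ L[x] (h may be taken of degree < l; the product mod x^l - 1
  -- is the cyclic convolution)
  InAplus : (l : ℕ) → .{{_ : NonZero l}} → Carrier → (Fin l → Carrier) → Set (c ⊔ ℓ)
  InAplus l z a =
    (∀ i → InSubfield (η l z) (a i)) ×
    Σ (Fin l → Carrier) λ h →
      (∀ j → InSubfield (η l z) (h j)) ×
      (∀ i → a i ≈ sumFin l (λ j → h j * coeff (fPoly l z) (subMod l i j)))

  InAinf : (l : ℕ) → .{{_ : NonZero l}} → Carrier → Carrier → (Fin l → Carrier) × Carrier → Set (c ⊔ ℓ)
  InAinf l z γ (a Data.Product., a∞) =
    InAplus l z a × (a∞ ≈ γ * sumFin l a)

  -- the monomial map σ (for l > 0):
  --   b_0 = a_∞ ,  b_i = (i/l) a_{-1/i} (0<i<l) ,  b_∞ = (-1/l) a_0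
  σ : (l : ℕ) → .{{_ : NonZero l}} → (Fin l → Carrier) × Carrier → (Fin l → Carrier) × Carrier
  σ l (a Data.Product., a∞) = b Data.Product., legendre l (l ∸ 1) * a (fromℕ< (m%n<n 0 l))
    where
    b : Fin l → Carrier
    b i with toℕ i
    ... | zero  = a∞
    ... | suc k = legendre l (suc k) * a (fromℕ< (m%n<n (negInv l (suc k)) l))

module Submission where

open import Defs
open import Level using (Level)
open import Data.Nat using (ℕ; suc; _<_; _∸_; NonZero)
open import Data.Nat.Primality using (Prime)
open import Data.Fin using (Fin)
open import Data.Product using (_×_)
open import Relation.Binary.PropositionalEquality using (_≢_)
open import Relation.Nullary using (¬_)

-- Since f(x) Σ xʲ ≡ f(1) Σ xʲ modulo xˡ - 1, the all-ones word is a multiple of f with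
-- multiplier f(1)⁻¹ Σ xʲ, which has coefficients in L as soon as f(1) ∈ L; then
-- (1, …, 1; γl) lies in A∞.  Its image under σ is (γl, (1/l), …, ((l-1)/l); ±1), and the
-- hypothesis puts it back in A⁺.  Every word of A⁺ is a multiple of f, hence vanishes at
-- the root z of f; evaluating at z gives γl + η - η′ = 0.
--
-- That f(1) = ∏_{r∈R} (1 - zʳ) lies in L = ℚ(η) follows from Newton's identities
-- (the field has characteristic 0): every power sum Σ_{r∈R} z^{ri} is a sum of ones, η, or
-- η′ = -1 - η, because multiplication by a unit modulo l permutes R when the unit is a
-- residue and maps R onto R′ otherwise.  The latter needs |R′| ≤ |R|, which holds since
-- the squares of 1, …, (l-1)/2 are pairwise incongruent.

module Counting where
  open import Data.Nat
  open import Data.Nat.Properties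
  open import Data.Bool using (Bool; true; false; if_then_else_)
  import Data.Bool.Properties as Bool
  open import Data.Fin using (Fin; toℕ; fromℕ<)
  open import Data.Fin.Properties using (any?; toℕ<n; toℕ-fromℕ<)
  open import Data.Product using (∃-syntax; _×_; _,_; proj₁; proj₂)
  open import Data.Empty using (⊥-elim)
  open import Relation.Nullary using (yes; no; _×-dec_)
  open import Algebra.Properties.CommutativeSemigroup +-commutativeSemigroup using (interchange)
  open import Relation.Binary.PropositionalEquality

  count : ℕ → (ℕ → Bool) → ℕ
  count zero    P = 0
  count (suc n) P = count n P + (if P n then 1 else 0)

  count-cong : ∀ n {P Q} → (∀ i → i < n → P i ≡ Q i) → count n P ≡ count n Q
  count-cong zero    eq = refl
  count-cong (suc n) eq =
    cong₂ (λ c b → c + (if b then 1 else 0)) (count-cong n (λ i i<n → eq i (m<n⇒m<1+n i<n))) (eq n ≤-refl)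

  count-partition : ∀ n (P Q R : ℕ → Bool) →
    (∀ i → i < n → (if P i then 1 else 0) + (if Q i then 1 else 0) ≡ (if R i then 1 else 0)) →
    count n P + count n Q ≡ count n R
  count-partition zero    P Q R eq = refl
  count-partition (suc n) P Q R eq =
    trans (interchange (count n P) _ (count n Q) _)
          (cong₂ _+_ (count-partition n P Q R (λ i i<n → eq i (m<n⇒m<1+n i<n))) (eq n ≤-refl))

  without : (ℕ → Bool) → ℕ → ℕ → Bool
  without Q y j with j ≟ y
  ... | yes _ = false
  ... | no  _ = Q j

  without-self : ∀ Q y → without Q y y ≡ false
  without-self Q y with y ≟ y
  ... | yes _   = refl
  ... | no y≢y = ⊥-elim (y≢y refl)

  without-≢ : ∀ Q {y j} → j ≢ y → without Q y j ≡ Q j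
  without-≢ Q {y} {j} j≢y with j ≟ y
  ... | yes j≡y = ⊥-elim (j≢y j≡y)
  ... | no  _   = refl

  count-without : ∀ n Q y → y < n → Q y ≡ true → count n Q ≡ suc (count n (without Q y))
  count-without (suc n) Q y y<1+n Qy with y ≟ n
  ... | yes refl rewrite Qy | without-self Q y =
    trans (+-comm (count y Q) 1)
          (cong suc (trans (count-cong y (λ j j<y → sym (without-≢ Q (<⇒≢ j<y)))) (sym (+-identityʳ _))))
  ... | no y≢n rewrite without-≢ Q (≢-sym y≢n) | count-without n Q y (≤∧≢⇒< (≤-pred y<1+n) y≢n) Qy = refl

  record Injection (n : ℕ) (P : ℕ → Bool) (n′ : ℕ) (Q : ℕ → Bool) (f : ℕ → ℕ) : Set where
    field
      maps-to   : ∀ i → i < n → P i ≡ true → f i < n′ × Q (f i) ≡ true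
      injective : ∀ i j → i < n → j < n → P i ≡ true → P j ≡ true → f i ≡ f j → i ≡ j

  open Injection

  restrict : ∀ {n P n′ Q f} → Injection (suc n) P n′ Q f → Injection n P n′ Q f
  restrict inj = record
    { maps-to   = λ i i<n → maps-to inj i (m<n⇒m<1+n i<n)
    ; injective = λ i j i<n j<n → injective inj i j (m<n⇒m<1+n i<n) (m<n⇒m<1+n j<n)
    }

  avoiding : ∀ {n P n′ Q f} y → Injection n P n′ Q f → (∀ i → i < n → P i ≡ true → f i ≢ y) →
             Injection n P n′ (without Q y) f
  avoiding {Q = Q} y inj miss = record
    { maps-to   = λ i i<n Pi → let fi<n′ , Qfi = maps-to inj i i<n Pi
                               in fi<n′ , trans (without-≢ Q (miss i i<n Pi)) Qfi
    ; injective = injective inj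
    }

  count-≤ : ∀ n {P n′ Q f} → Injection n P n′ Q f → count n P ≤ count n′ Q
  count-≤ zero    inj = z≤n
  count-≤ (suc n) {P} {n′} {Q} {f} inj with P n in Pn
  ... | false = subst (_≤ count n′ Q) (sym (+-identityʳ _)) (count-≤ n (restrict inj))
  ... | true  = begin
      count n P + 1                  ≡⟨ +-comm (count n P) 1 ⟩
      suc (count n P)                ≤⟨ s≤s (count-≤ n (avoiding (f n) (restrict inj) miss)) ⟩
      suc (count n′ (without Q (f n))) ≡⟨ count-without n′ Q (f n) fn<n′ Qfn ⟨
      count n′ Q                     ∎
    where
    open ≤-Reasoning
    fn<n′ = proj₁ (maps-to inj n ≤-refl Pn)
    Qfn = proj₂ (maps-to inj n ≤-refl Pn)
    miss : ∀ i → i < n → P i ≡ true → f i ≢ f n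
    miss i i<n Pi fi≡fn = <⇒≢ i<n (injective inj i n (m<n⇒m<1+n i<n) ≤-refl Pi Pn fi≡fn)

  onto : ∀ n {P n′ Q f} → Injection n P n′ Q f → count n′ Q ≤ count n P →
         ∀ y → y < n′ → Q y ≡ true → ∃[ x ] (x < n × P x ≡ true × f x ≡ y)
  onto n {P} {n′} {Q} {f} inj Q≤P y y<n′ Qy
    with any? (λ (x : Fin n) → (P (toℕ x) Bool.≟ true) ×-dec (f (toℕ x) ≟ y))
  ... | yes (x , Px , fx≡y) = toℕ x , toℕ<n x , Px , fx≡y
  ... | no ∄x = ⊥-elim (<-irrefl refl (begin-strict
      count n P                       ≤⟨ count-≤ n (avoiding y inj miss) ⟩
      count n′ (without Q y)          <⟨ n<1+n _ ⟩
      suc (count n′ (without Q y))    ≡⟨ count-without n′ Q y y<n′ Qy ⟨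
      count n′ Q                      ≤⟨ Q≤P ⟩
      count n P                       ∎))
    where
    open ≤-Reasoning
    miss : ∀ i → i < n → P i ≡ true → f i ≢ y
    miss i i<n Pi fi≡y = ∄x (fromℕ< i<n , subst (λ k → P k ≡ true × f k ≡ y) (sym (toℕ-fromℕ< i<n)) (Pi , fi≡y))

  nonzero : ℕ → Bool
  nonzero zero    = false
  nonzero (suc _) = true

  count-nonzero : ∀ n → count (suc n) nonzero ≡ n
  count-nonzero zero    = refl
  count-nonzero (suc n) = trans (cong (_+ 1) (count-nonzero n)) (+-comm n 1)

module Residues where
  open import Data.Nat
  open import Data.Nat.Properties
  open import Data.Nat.DivMod
  open import Data.Nat.Divisibility
  open import Data.Nat.Primality
  open import Data.Nat.Tactic.RingSolver using (solve-∀)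
  open import Data.Bool using (Bool; true; false; if_then_else_)
  open import Data.Bool.Properties using (T-≡)
  open import Data.Product using (∃-syntax; _×_; _,_; proj₁)
  open import Data.Sum using (inj₁; inj₂)
  open import Data.Empty using (⊥-elim)
  open import Relation.Nullary using (yes; no)
  open import Relation.Binary.PropositionalEquality
  open import Function.Bundles using (Equivalence)
  open import Defs using (anyBelow; isQR)
  open Counting

  true≢false : true ≢ false
  true≢false ()

  module Modular (l : ℕ) .{{_ : NonZero l}} where

    %-≡⇒∣∸ : ∀ {x y} → y ≤ x → x % l ≡ y % l → l ∣ x ∸ y
    %-≡⇒∣∸ {x} {y} y≤x x≡y = divides (x / l ∸ y / l) (begin
      x ∸ y
        ≡⟨ cong₂ _∸_ (m≡m%n+[m/n]*n x l) (trans (m≡m%n+[m/n]*n y l) (cong (_+ y / l * l) (sym x≡y))) ⟩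
      (x % l + x / l * l) ∸ (x % l + y / l * l)     ≡⟨ [m+n]∸[m+o]≡n∸o (x % l) _ _ ⟩
      x / l * l ∸ y / l * l                         ≡⟨ *-distribʳ-∸ l (x / l) (y / l) ⟨
      (x / l ∸ y / l) * l                           ∎)
      where open ≡-Reasoning

    ∣∧<⇒≡0 : ∀ {d} → l ∣ d → d < l → d ≡ 0
    ∣∧<⇒≡0 {zero}  _   _   = refl
    ∣∧<⇒≡0 {suc d} l∣d d<l = ⊥-elim (<⇒≱ d<l (∣⇒≤ l∣d))

    *-cong-% : ∀ a a′ b b′ → a % l ≡ a′ % l → b % l ≡ b′ % l → (a * b) % l ≡ (a′ * b′) % l
    *-cong-% a a′ b b′ a≡a′ b≡b′ =
      trans (%-distribˡ-* a b l) (trans (cong₂ (λ u v → (u * v) % l) a≡a′ b≡b′) (sym (%-distribˡ-* a′ b′ l)))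

    shift-%-inverse : ∀ a b x → a + b ≡ l → x < l → ((x + a) % l + b) % l ≡ x
    shift-%-inverse a b x a+b≡l x<l = begin
      ((x + a) % l + b) % l  ≡⟨ %-distribˡ-+ ((x + a) % l) b l ⟩
      ((x + a) % l % l + b % l) % l  ≡⟨ cong (λ u → (u + b % l) % l) (m%n%n≡m%n (x + a) l) ⟩
      ((x + a) % l + b % l) % l  ≡⟨ %-distribˡ-+ (x + a) b l ⟨
      (x + a + b) % l  ≡⟨ cong (_% l) (trans (+-assoc x a b) (cong (x +_) a+b≡l)) ⟩
      (x + l) % l  ≡⟨ [m+n]%n≡m%n x l ⟩
      x % l  ≡⟨ m<n⇒m%n≡m x<l ⟩
      x ∎
      where open ≡-Reasoning

    reflect-%-involutive : ∀ i j → j < l → (l + i ∸ (l + i ∸ j) % l) % l ≡ j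
    reflect-%-involutive i j j<l = begin
      (l + i ∸ d % l) % l                     ≡⟨ cong (λ u → (u ∸ d % l) % l) (m∸n+n≡m j≤l+i) ⟨
      (d + j ∸ d % l) % l                     ≡⟨ cong (λ u → (u + j ∸ d % l) % l) (m≡m%n+[m/n]*n d l) ⟩
      (d % l + d / l * l + j ∸ d % l) % l     ≡⟨ cong (λ u → (u ∸ d % l) % l) (+-assoc (d % l) (d / l * l) j) ⟩
      (d % l + (d / l * l + j) ∸ d % l) % l   ≡⟨ cong (_% l) (m+n∸m≡n (d % l) _) ⟩
      (d / l * l + j) % l                     ≡⟨ cong (_% l) (+-comm (d / l * l) j) ⟩
      (j + d / l * l) % l                     ≡⟨ [m+kn]%n≡m%n j (d / l) l ⟩
      j % l                                   ≡⟨ m<n⇒m%n≡m j<l ⟩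
      j                                       ∎
      where
      open ≡-Reasoning
      d = l + i ∸ j
      j≤l+i : j ≤ l + i
      j≤l+i = ≤-trans (<⇒≤ j<l) (m≤m+n l i)

  module PrimeModulus (l : ℕ) .{{_ : NonZero l}} (l-prime : Prime l) where
    open Modular l public

    1<l : 1 < l
    1<l = nonTrivial⇒n>1 l {{prime⇒nonTrivial l-prime}}

    1%l≡1 : 1 % l ≡ 1
    1%l≡1 = m<n⇒m%n≡m 1<l

    unit-≢0 : ∀ a b → (a * b) % l ≡ 1 → a % l ≢ 0
    unit-≢0 a b ab≡1 a≡0 = 1+n≢0 (trans (sym ab≡1) (trans (*-cong-% a 0 b b (trans a≡0 (sym 0%l≡0)) refl) 0%l≡0))
      where
      0%l≡0 : 0 % l ≡ 0
      0%l≡0 = m*n%n≡0 0 l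

    *-≢0-% : ∀ a b → a % l ≢ 0 → b % l ≢ 0 → (a * b) % l ≢ 0
    *-≢0-% a b a≢0 b≢0 ab≡0 with euclidsLemma a b l-prime (m%n≡0⇒n∣m (a * b) l ab≡0)
    ... | inj₁ l∣a = a≢0 (n∣m⇒m%n≡0 a l l∣a)
    ... | inj₂ l∣b = b≢0 (n∣m⇒m%n≡0 b l l∣b)

    *-cancelˡ-%-≥ : ∀ a {x y} → a % l ≢ 0 → y ≤ x → x < l → (a * x) % l ≡ (a * y) % l → x ≡ y
    *-cancelˡ-%-≥ a {x} {y} a≢0 y≤x x<l ax≡ay
      with euclidsLemma a (x ∸ y) l-prime
             (subst (l ∣_) (sym (*-distribˡ-∸ a x y)) (%-≡⇒∣∸ (*-monoʳ-≤ a y≤x) ax≡ay))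
    ... | inj₁ l∣a   = ⊥-elim (a≢0 (n∣m⇒m%n≡0 a l l∣a))
    ... | inj₂ l∣x∸y = ≤-antisym (m∸n≡0⇒m≤n (∣∧<⇒≡0 l∣x∸y (≤-<-trans (m∸n≤m x y) x<l))) y≤x

    *-cancelˡ-% : ∀ a {x y} → a % l ≢ 0 → x < l → y < l → (a * x) % l ≡ (a * y) % l → x ≡ y
    *-cancelˡ-% a {x} {y} a≢0 x<l y<l ax≡ay with ≤-total y x
    ... | inj₁ y≤x = *-cancelˡ-%-≥ a a≢0 y≤x x<l ax≡ay
    ... | inj₂ x≤y = sym (*-cancelˡ-%-≥ a a≢0 x≤y y<l (sym ax≡ay))

    inverse-% : ∀ a → a % l ≢ 0 → ∃[ b ] (b < l × (a * b) % l ≡ 1)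
    inverse-% a a≢0 =
      let b , b<l , _ , ab≡1 = onto l multiplication ≤-refl 1 1<l refl in b , b<l , ab≡1
      where
      multiplication : Injection l (λ _ → true) l (λ _ → true) (λ x → (a * x) % l)
      multiplication = record
        { maps-to   = λ x _ _ → m%n<n (a * x) l , refl
        ; injective = λ x y x<l y<l _ _ → *-cancelˡ-% a a≢0 x<l y<l
        }

    *-inverse-%-cancel : ∀ a b x → (a * b) % l ≡ 1 → x < l → ((x * a) % l * b) % l ≡ x
    *-inverse-%-cancel a b x ab≡1 x<l = begin
      ((x * a) % l * b) % l  ≡⟨ *-cong-% ((x * a) % l) (x * a) b b (m%n%n≡m%n (x * a) l) refl ⟩
      (x * a * b) % l        ≡⟨ cong (_% l) (*-assoc x a b) ⟩
      (x * (a * b)) % l      ≡⟨ *-cong-% x x (a * b) 1 refl (trans ab≡1 (sym 1%l≡1)) ⟩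
      (x * 1) % l            ≡⟨ cong (_% l) (*-identityʳ x) ⟩
      x % l                  ≡⟨ m<n⇒m%n≡m x<l ⟩
      x                      ∎
      where open ≡-Reasoning

  ≡⇒≡ᵇ≡true : ∀ {m n} → m ≡ n → (m ≡ᵇ n) ≡ true
  ≡⇒≡ᵇ≡true {m} {n} m≡n = Equivalence.to T-≡ (≡⇒≡ᵇ m n m≡n)

  ≡ᵇ≡true⇒≡ : ∀ {m n} → (m ≡ᵇ n) ≡ true → m ≡ n
  ≡ᵇ≡true⇒≡ {m} {n} e = ≡ᵇ⇒≡ m n (Equivalence.from T-≡ e)

  ≢⇒≡ᵇ≡false : ∀ {m n} → m ≢ n → (m ≡ᵇ n) ≡ false
  ≢⇒≡ᵇ≡false {m} {n} m≢n with m ≡ᵇ n in e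
  ... | true  = ⊥-elim (m≢n (≡ᵇ≡true⇒≡ e))
  ... | false = refl

  anyBelow-intro : ∀ n P x → x < n → P x ≡ true → anyBelow n P ≡ true
  anyBelow-intro (suc n) P x x<1+n Px with P n in Pn
  ... | true  = refl
  ... | false with x ≟ n
  ...   | yes refl = ⊥-elim (true≢false (trans (sym Px) Pn))
  ...   | no x≢n   = anyBelow-intro n P x (≤∧≢⇒< (≤-pred x<1+n) x≢n) Px

  anyBelow-elim : ∀ n P → anyBelow n P ≡ true → ∃[ x ] (x < n × P x ≡ true)
  anyBelow-elim (suc n) P any with P n in Pn
  ... | true  = n , ≤-refl , Pn
  ... | false = let x , x<n , Px = anyBelow-elim n P any in x , m<n⇒m<1+n x<n , Px

  module QuadraticResidues (k : ℕ) (l-prime : Prime (suc k)) (m : ℕ) (k≡m+m : k ≡ m + m) where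
    open PrimeModulus (suc k) l-prime public

    l : ℕ
    l = suc k

    isQNR : ℕ → Bool
    isQNR s = if s ≡ᵇ 0 then false else (if isQR l s then false else true)

    isQR-intro : ∀ r x → r % l ≢ 0 → (x * x) % l ≡ r % l → isQR l r ≡ true
    isQR-intro r x r≢0 x²≡r rewrite ≢⇒≡ᵇ≡false r≢0 =
      anyBelow-intro l _ (x % l) (m%n<n x l) (≡⇒≡ᵇ≡true (trans (sym (%-distribˡ-* x x l)) x²≡r))

    isQR-elim : ∀ r → isQR l r ≡ true → r % l ≢ 0 × ∃[ x ] ((x * x) % l ≡ r % l)
    isQR-elim r qr with r % l ≡ᵇ 0 in r≡ᵇ0
    ... | false = (λ r≡0 → true≢false (trans (sym (≡⇒≡ᵇ≡true r≡0)) r≡ᵇ0))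
                , (let x , _ , x²≡r = anyBelow-elim l _ qr in x , ≡ᵇ≡true⇒≡ x²≡r)

    isQR-cong : ∀ r r′ → r % l ≡ r′ % l → isQR l r ≡ isQR l r′
    isQR-cong r r′ r≡r′ rewrite r≡r′ = refl

    isQR-% : ∀ r → isQR l (r % l) ≡ isQR l r
    isQR-% r = isQR-cong (r % l) r (m%n%n≡m%n r l)

    isQR-≢0 : ∀ r → isQR l r ≡ true → r % l ≢ 0
    isQR-≢0 r qr = proj₁ (isQR-elim r qr)

    isQR-0 : ∀ r → r % l ≡ 0 → isQR l r ≡ false
    isQR-0 r r≡0 rewrite r≡0 = refl

    isQR-1 : isQR l 1 ≡ true
    isQR-1 = isQR-intro 1 1 (λ 1≡0 → 1+n≢0 (trans (sym 1%l≡1) 1≡0)) refl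

    isQR-square : ∀ a → a % l ≢ 0 → isQR l (a * a) ≡ true
    isQR-square a a≢0 = isQR-intro (a * a) a (*-≢0-% a a a≢0 a≢0) refl

    isQR-*-res-res : ∀ a b → isQR l a ≡ true → isQR l b ≡ true → isQR l (a * b) ≡ true
    isQR-*-res-res a b qa qb =
      let a≢0 , x , x²≡a = isQR-elim a qa
          b≢0 , y , y²≡b = isQR-elim b qb
      in isQR-intro (a * b) (x * y) (*-≢0-% a b a≢0 b≢0)
           (trans (cong (_% l) (interchange x y)) (*-cong-% (x * x) a (y * y) b x²≡a y²≡b))
      where
      interchange : ∀ x y → (x * y) * (x * y) ≡ (x * x) * (y * y)
      interchange = solve-∀

    -- a ≡ (y x⁻¹)² where x² ≡ b and y² ≡ a b
    isQR-quotient : ∀ a b → a % l ≢ 0 → isQR l b ≡ true → isQR l (a * b) ≡ true → isQR l a ≡ true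
    isQR-quotient a b a≢0 qb qab with isQR-elim b qb | isQR-elim (a * b) qab
    ... | b≢0 , x , x²≡b | _ , y , y²≡ab with inverse-% x x≢0
      where
      x≢0 : x % l ≢ 0
      x≢0 x≡0 = b≢0 (trans (sym x²≡b) (trans (%-distribˡ-* x x l) (cong (λ u → (u * u) % l) x≡0)))
    ... | x′ , _ , xx′≡1 = isQR-intro a (y * x′) a≢0 (begin
      ((y * x′) * (y * x′)) % l          ≡⟨ cong (_% l) (interchange y x′) ⟩
      ((y * y) * (x′ * x′)) % l          ≡⟨ *-cong-% (y * y) (a * b) (x′ * x′) (x′ * x′) y²≡ab refl ⟩
      ((a * b) * (x′ * x′)) % l
        ≡⟨ *-cong-% (a * b) (a * (x * x)) (x′ * x′) (x′ * x′) (*-cong-% a a b (x * x) refl (sym x²≡b)) refl ⟩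
      ((a * (x * x)) * (x′ * x′)) % l    ≡⟨ cong (_% l) (regroup a x x′) ⟩
      (a * ((x * x′) * (x * x′))) % l
        ≡⟨ *-cong-% a a ((x * x′) * (x * x′)) 1 refl (*-cong-% (x * x′) 1 (x * x′) 1 xx′≡1′ xx′≡1′) ⟩
      (a * 1) % l                        ≡⟨ cong (_% l) (*-identityʳ a) ⟩
      a % l                              ∎)
      where
      open ≡-Reasoning
      xx′≡1′ : (x * x′) % l ≡ 1 % l
      xx′≡1′ = trans xx′≡1 (sym 1%l≡1)
      interchange : ∀ y x′ → (y * x′) * (y * x′) ≡ (y * y) * (x′ * x′)
      interchange = solve-∀
      regroup : ∀ a x x′ → (a * (x * x)) * (x′ * x′) ≡ a * ((x * x′) * (x * x′))
      regroup = solve-∀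

    isQR-*-nonres-res : ∀ a b → a % l ≢ 0 → isQR l a ≡ false → isQR l b ≡ true → isQR l (a * b) ≡ false
    isQR-*-nonres-res a b a≢0 qa qb with isQR l (a * b) in qab
    ... | false = refl
    ... | true  = ⊥-elim (true≢false (trans (sym (isQR-quotient a b a≢0 qb qab)) qa))

    private
      square-difference : ∀ x y → y ≤ x → x * x ∸ y * y ≡ (x + y) * (x ∸ y)
      square-difference x y y≤x = begin
        x * x ∸ y * y                     ≡⟨ cong (λ u → u * u ∸ y * y) (m+[n∸m]≡n y≤x) ⟨
        (y + d) * (y + d) ∸ y * y         ≡⟨ cong (_∸ y * y) (expand y d) ⟩
        y * y + (y + d + y) * d ∸ y * y   ≡⟨ m+n∸m≡n (y * y) _ ⟩
        (y + d + y) * d                   ≡⟨ cong (λ u → (u + y) * d) (m+[n∸m]≡n y≤x) ⟩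
        (x + y) * (x ∸ y)                 ∎
        where
        open ≡-Reasoning
        d = x ∸ y
        expand : ∀ y d → (y + d) * (y + d) ≡ y * y + (y + d + y) * d
        expand = solve-∀

      m<l : m < l
      m<l = s≤s (subst (m ≤_) (sym k≡m+m) (m≤m+n m m))

      x+y<l : ∀ {x y} → x ≤ m → y ≤ m → x + y < l
      x+y<l x≤m y≤m = s≤s (subst (_ ≤_) (sym k≡m+m) (+-mono-≤ x≤m y≤m))

      squares-injective-≥ : ∀ {x y} → 0 < x → x ≤ m → y ≤ m → y ≤ x → (x * x) % l ≡ (y * y) % l → x ≡ y
      squares-injective-≥ {x} {y} 0<x x≤m y≤m y≤x x²≡y²
        with euclidsLemma (x + y) (x ∸ y) l-prime
               (subst (l ∣_) (square-difference x y y≤x) (%-≡⇒∣∸ (*-mono-≤ y≤x y≤x) x²≡y²))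
      ... | inj₁ l∣x+y = ⊥-elim (<⇒≢ (<-≤-trans 0<x (m≤m+n x y)) (sym (∣∧<⇒≡0 l∣x+y (x+y<l x≤m y≤m))))
      ... | inj₂ l∣x∸y =
        ≤-antisym (m∸n≡0⇒m≤n (∣∧<⇒≡0 l∣x∸y (≤-<-trans (m∸n≤m x y) (≤-<-trans (m≤m+n x y) (x+y<l x≤m y≤m))))) y≤x

    squares-injective : ∀ {x y} → 0 < x → 0 < y → x ≤ m → y ≤ m → (x * x) % l ≡ (y * y) % l → x ≡ y
    squares-injective 0<x 0<y x≤m y≤m x²≡y² with ≤-total _ _
    ... | inj₁ y≤x = squares-injective-≥ 0<x x≤m y≤m y≤x x²≡y²
    ... | inj₂ x≤y = sym (squares-injective-≥ 0<y y≤m x≤m x≤y (sym x²≡y²))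

    count-QR≥ : m ≤ count l (isQR l)
    count-QR≥ = subst (_≤ count l (isQR l)) (count-nonzero m) (count-≤ (suc m) squaring)
      where
      squaring : Injection (suc m) nonzero l (isQR l) (λ x → (x * x) % l)
      squaring = record
        { maps-to   = λ { (suc x) 1+x<1+m _ →
            m%n<n (suc x * suc x) l ,
            trans (isQR-% (suc x * suc x)) (isQR-square (suc x) (1+x%l≢0 (≤-pred 1+x<1+m))) }
        ; injective = λ { (suc x) (suc y) 1+x<1+m 1+y<1+m _ _ →
            squares-injective (s≤s z≤n) (s≤s z≤n) (≤-pred 1+x<1+m) (≤-pred 1+y<1+m) }
        }
        where
        1+x%l≢0 : ∀ {x} → suc x ≤ m → suc x % l ≢ 0
        1+x%l≢0 1+x≤m = subst (_≢ 0) (sym (m<n⇒m%n≡m (≤-<-trans 1+x≤m m<l))) λ ()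

    isQNR-intro : ∀ s → s ≢ 0 → isQR l s ≡ false → isQNR s ≡ true
    isQNR-intro s s≢0 qs rewrite ≢⇒≡ᵇ≡false s≢0 | qs = refl

    count-QR+QNR : count l (isQR l) + count l isQNR ≡ m + m
    count-QR+QNR = trans (count-partition l (isQR l) isQNR nonzero (λ i _ → split i))
                         (trans (count-nonzero k) k≡m+m)
      where
      split : ∀ i → (if isQR l i then 1 else 0) + (if isQNR i then 1 else 0) ≡ (if nonzero i then 1 else 0)
      split zero    = refl
      split (suc i) with isQR l (suc i)
      ... | true  = refl
      ... | false = refl

    count-QNR≤QR : count l isQNR ≤ count l (isQR l)
    count-QNR≤QR = ≤-trans QNR≤m count-QR≥
      where
      QNR≤m : count l isQNR ≤ m
      QNR≤m = +-cancelˡ-≤ m (count l isQNR) m (begin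
        m + count l isQNR                ≤⟨ +-monoˡ-≤ (count l isQNR) count-QR≥ ⟩
        count l (isQR l) + count l isQNR ≡⟨ count-QR+QNR ⟩
        m + m                            ∎)
        where open ≤-Reasoning

    -- multiplication by a nonresidue injects the residues into the equally many nonresidues,
    -- so every nonresidue b is a r with r a residue, and a b ≡ a² r
    isQR-*-nonres-nonres : ∀ a b → a % l ≢ 0 → isQR l a ≡ false → b % l ≢ 0 → isQR l b ≡ false →
                           isQR l (a * b) ≡ true
    isQR-*-nonres-nonres a b a≢0 qa b≢0 qb
      with onto l scaling count-QNR≤QR (b % l) (m%n<n b l)
             (isQNR-intro (b % l) b≢0 (trans (isQR-% b) qb))
      where
      scaling : Injection l (isQR l) l isQNR (λ r → (a * r) % l)
      scaling = record
        { maps-to   = λ r _ qr →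
            m%n<n (a * r) l ,
            isQNR-intro ((a * r) % l)
              (*-≢0-% a r a≢0 (isQR-≢0 r qr))
              (trans (isQR-% (a * r)) (isQR-*-nonres-res a r a≢0 qa qr))
        ; injective = λ r r′ r<l r′<l _ _ → *-cancelˡ-% a a≢0 r<l r′<l
        }
    ... | r , _ , qr , ar≡b = begin
      isQR l (a * b)        ≡⟨ isQR-cong (a * b) (a * (a * r)) (*-cong-% a a b (a * r) refl (sym ar≡b)) ⟩
      isQR l (a * (a * r))  ≡⟨ cong (isQR l) (*-assoc a a r) ⟨
      isQR l (a * a * r)    ≡⟨ isQR-*-res-res (a * a) r (isQR-square a a≢0) qr ⟩
      true                  ∎
      where open ≡-Reasoning

    isQR-*-res : ∀ κ → isQR l κ ≡ true → ∀ j → isQR l (j * κ) ≡ isQR l j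
    isQR-*-res κ qκ j with isQR l j in qj
    ... | true = isQR-*-res-res j κ qj qκ
    ... | false with j % l ≟ 0
    ...   | yes j≡0 = isQR-0 (j * κ) (*-cong-% j 0 κ κ j≡0 refl)
    ...   | no  j≢0 = isQR-*-nonres-res j κ j≢0 qj qκ

    isQR-*-nonres : ∀ κ → κ % l ≢ 0 → isQR l κ ≡ false → ∀ j → j < l → isQR l (j * κ) ≡ isQNR j
    isQR-*-nonres κ κ≢0 qκ zero    _     = refl
    isQR-*-nonres κ κ≢0 qκ (suc j) 1+j<l with isQR l (suc j) in qj
    ... | true  = trans (cong (isQR l) (*-comm (suc j) κ)) (isQR-*-nonres-res κ (suc j) κ≢0 qκ qj)
    ... | false = trans (cong (isQR l) (*-comm (suc j) κ)) (isQR-*-nonres-nonres κ (suc j) κ≢0 qκ 1+j≢0 qj)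
      where
      1+j≢0 : suc j % l ≢ 0
      1+j≢0 = subst (_≢ 0) (sym (m<n⇒m%n≡m 1+j<l)) λ ()

module FieldTheory where
  open import Data.Nat as ℕ using (ℕ; zero; suc; _<_; _≤_; s≤s)
  import Data.Nat.Properties as ℕ
  open import Data.Bool using (Bool; true; false; if_then_else_)
  open import Data.Fin as Fin using (Fin; toℕ; fromℕ<)
  import Data.Fin.Properties as Fin
  open import Data.Fin.Permutation using (permutation)
  open import Data.Product using (_,_)
  open import Relation.Nullary using (¬_; yes; no)
  open import Relation.Binary.PropositionalEquality as ≡ using (_≡_)

  module FieldProperties {c ℓ} (F : Field c ℓ) where
    open Field F hiding (zero)
    open import Relation.Binary.Reasoning.Setoid setoid

    *-cancel-≉0 : ∀ {x y} → ¬ (x ≈ 0#) → x * y ≈ 0# → y ≈ 0#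
    *-cancel-≉0 {x} {y} x≉0 xy≈0 with inverse x x≉0
    ... | x⁻¹ , xx⁻¹≈1 = begin
      y                 ≈⟨ *-identityˡ y ⟨
      1# * y            ≈⟨ *-congʳ xx⁻¹≈1 ⟨
      (x * x⁻¹) * y     ≈⟨ *-congʳ (*-comm x x⁻¹) ⟩
      (x⁻¹ * x) * y     ≈⟨ *-assoc x⁻¹ x y ⟩
      x⁻¹ * (x * y)     ≈⟨ *-congˡ xy≈0 ⟩
      x⁻¹ * 0#          ≈⟨ zeroʳ x⁻¹ ⟩
      0#                ∎

    if-cong : ∀ {b b′ x x′} → b ≡ b′ → x ≈ x′ → (if b then x else 0#) ≈ (if b′ then x′ else 0#)
    if-cong {true}  ≡.refl x≈x′ = x≈x′
    if-cong {false} ≡.refl x≈x′ = refl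

    *-≉0 : ∀ {x y} → ¬ (x ≈ 0#) → ¬ (y ≈ 0#) → ¬ (x * y ≈ 0#)
    *-≉0 x≉0 y≉0 xy≈0 = y≉0 (*-cancel-≉0 x≉0 xy≈0)

  module Sums {c ℓ} (F : Field c ℓ) where
    open Field F hiding (zero)
    open import Relation.Binary.Reasoning.Setoid setoid
    open import Algebra.Properties.Ring ring using (-0#≈0#; -‿+-comm)
    open import Algebra.Properties.CommutativeSemigroup +-commutativeSemigroup using (interchange)
    open import Algebra.Properties.CommutativeMonoid.Sum +-commutativeMonoid using (sum; sum-permute; sum-cong-≗)

    ∑ : ℕ → (ℕ → Carrier) → Carrier
    ∑ = sumBelow F

    ∑-cong : ∀ n {g h} → (∀ i → i < n → g i ≈ h i) → ∑ n g ≈ ∑ n h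
    ∑-cong zero    g≈h = refl
    ∑-cong (suc n) g≈h = +-cong (∑-cong n (λ i i<n → g≈h i (ℕ.m<n⇒m<1+n i<n))) (g≈h n ℕ.≤-refl)

    ∑-zero : ∀ n → ∑ n (λ _ → 0#) ≈ 0#
    ∑-zero zero    = refl
    ∑-zero (suc n) = trans (+-identityʳ _) (∑-zero n)

    ∑-distrib-+ : ∀ n g h → ∑ n (λ i → g i + h i) ≈ ∑ n g + ∑ n h
    ∑-distrib-+ zero    g h = sym (+-identityʳ 0#)
    ∑-distrib-+ (suc n) g h = trans (+-congʳ (∑-distrib-+ n g h)) (interchange (∑ n g) (∑ n h) (g n) (h n))

    *-distribˡ-∑ : ∀ n a g → ∑ n (λ i → a * g i) ≈ a * ∑ n g
    *-distribˡ-∑ zero    a g = sym (zeroʳ a)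
    *-distribˡ-∑ (suc n) a g = trans (+-congʳ (*-distribˡ-∑ n a g)) (sym (distribˡ a (∑ n g) (g n)))

    -‿distrib-∑ : ∀ n g → ∑ n (λ i → - g i) ≈ - ∑ n g
    -‿distrib-∑ zero    g = sym -0#≈0#
    -‿distrib-∑ (suc n) g = trans (+-congʳ (-‿distrib-∑ n g)) (-‿+-comm (∑ n g) (g n))

    ∑-unroll : ∀ n g → ∑ (suc n) g ≈ g 0 + ∑ n (λ i → g (suc i))
    ∑-unroll zero    g = trans (+-identityˡ _) (sym (+-identityʳ _))
    ∑-unroll (suc n) g = trans (+-congʳ (∑-unroll n g)) (+-assoc _ _ _)

    sumFin≈∑ : ∀ n (g : Fin n → Carrier) (g′ : ℕ → Carrier) → (∀ j → g j ≈ g′ (toℕ j)) → sumFin F n g ≈ ∑ n g′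
    sumFin≈∑ zero    g g′ g≈g′ = refl
    sumFin≈∑ (suc n) g g′ g≈g′ =
      trans (+-cong (g≈g′ Fin.zero) (sumFin≈∑ n (λ i → g (Fin.suc i)) (λ i → g′ (suc i)) (λ j → g≈g′ (Fin.suc j))))
            (sym (∑-unroll n g′))

    sumFin≡sum : ∀ n {g : Fin n → Carrier} → sumFin F n g ≡ sum g
    sumFin≡sum zero    = ≡.refl
    sumFin≡sum (suc n) = ≡.cong (_ +_) (sumFin≡sum n)

    sum≈∑ : ∀ n g → sum {n} (λ i → g (toℕ i)) ≈ ∑ n g
    sum≈∑ n g = trans (reflexive (≡.sym (sumFin≡sum n))) (sumFin≈∑ n _ g (λ _ → refl))

    ∑-permute : ∀ n (p p′ : ℕ → ℕ) g →
      (∀ i → i < n → p i < n) → (∀ i → i < n → p′ i < n) →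
      (∀ i → i < n → p (p′ i) ≡ i) → (∀ i → i < n → p′ (p i) ≡ i) →
      ∑ n (λ i → g (p i)) ≈ ∑ n g
    ∑-permute n p p′ g p<n p′<n pp′ p′p = begin
      ∑ n (λ i → g (p i))                ≈⟨ sum≈∑ n (λ i → g (p i)) ⟨
      sum {n} (λ i → g (p (toℕ i)))      ≡⟨ sum-cong-≗ {n} (λ i → ≡.cong g (≡.sym (Fin.toℕ-fromℕ< _))) ⟩
      sum {n} (λ i → g (toℕ (π′ i)))     ≈⟨ sum-permute (λ i → g (toℕ i)) π ⟨
      sum {n} (λ i → g (toℕ i))          ≈⟨ sum≈∑ n g ⟩
      ∑ n g                              ∎
      where
      onFin : (q : ℕ → ℕ) → (∀ i → i < n → q i < n) → Fin n → Fin n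
      onFin q q<n i = fromℕ< (q<n (toℕ i) (Fin.toℕ<n i))

      onFin-inverse : ∀ q q′ q<n q′<n → (∀ i → i < n → q (q′ i) ≡ i) → ∀ i → onFin q q<n (onFin q′ q′<n i) ≡ i
      onFin-inverse q q′ q<n q′<n qq′ i = Fin.toℕ-injective
        (≡.trans (Fin.toℕ-fromℕ< _) (≡.trans (≡.cong q (Fin.toℕ-fromℕ< _)) (qq′ (toℕ i) (Fin.toℕ<n i))))

      π′ = onFin p p<n
      π = permutation π′ (onFin p′ p′<n) (onFin-inverse p p′ p<n p′<n pp′) (onFin-inverse p′ p p′<n p<n p′p)

  module Powers {c ℓ} (F : Field c ℓ) where
    open Field F hiding (zero)
    open import Relation.Binary.Reasoning.Setoid setoid
    open import Algebra.Properties.Ring ring using (-1*x≈-x)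
    open import Algebra.Properties.Semiring.Exp semiring using (_^_; ^-congˡ; ^-homo-*; ^-assocʳ)
    open import Algebra.Solver.CommutativeMonoid +-commutativeMonoid using (solve; _⊕_; _⊜_)
    open Sums F

    pow≡^ : ∀ x n → pow F x n ≡ x ^ n
    pow≡^ x zero    = ≡.refl
    pow≡^ x (suc n) = ≡.cong (x *_) (pow≡^ x n)

    pow-congˡ : ∀ {x y} n → x ≈ y → pow F x n ≈ pow F y n
    pow-congˡ {x} {y} n x≈y rewrite pow≡^ x n | pow≡^ y n = ^-congˡ n x≈y

    pow-+ : ∀ x m n → pow F x (m ℕ.+ n) ≈ pow F x m * pow F x n
    pow-+ x m n rewrite pow≡^ x (m ℕ.+ n) | pow≡^ x m | pow≡^ x n = ^-homo-* x m n

    pow-* : ∀ x m n → pow F x (m ℕ.* n) ≈ pow F (pow F x m) n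
    pow-* x m n rewrite pow≡^ x (m ℕ.* n) | pow≡^ x m | pow≡^ (x ^ m) n = sym (^-assocʳ x m n)

    pow-1# : ∀ n → pow F 1# n ≈ 1#
    pow-1# zero    = refl
    pow-1# (suc n) = trans (*-identityˡ _) (pow-1# n)

    geometric-sum : ∀ x n → (x - 1#) * ∑ n (pow F x) ≈ pow F x n - 1#
    geometric-sum x zero    = trans (zeroʳ _) (sym (-‿inverseʳ 1#))
    geometric-sum x (suc n) = begin
      (x - 1#) * (∑ n (pow F x) + u)           ≈⟨ distribˡ (x - 1#) _ u ⟩
      (x - 1#) * ∑ n (pow F x) + (x - 1#) * u  ≈⟨ +-cong (geometric-sum x n) (distribʳ u x (- 1#)) ⟩
      (u - 1#) + (x * u + - 1# * u)            ≈⟨ +-congˡ (+-congˡ (-1*x≈-x u)) ⟩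
      (u - 1#) + (x * u - u)
        ≈⟨ solve 4 (λ u m v n → (u ⊕ m) ⊕ (v ⊕ n) ⊜ (v ⊕ m) ⊕ (u ⊕ n)) refl u (- 1#) (x * u) (- u) ⟩
      (x * u - 1#) + (u - u)                   ≈⟨ +-congˡ (-‿inverseʳ u) ⟩
      (x * u - 1#) + 0#                        ≈⟨ +-identityʳ _ ⟩
      x * u - 1#                               ∎
      where u = pow F x n

  module Polynomials {c ℓ} (F : Field c ℓ) where
    open Field F hiding (zero)
    open import Relation.Binary.Reasoning.Setoid setoid
    open import Algebra.Properties.CommutativeSemigroup +-commutativeSemigroup using (interchange)
    open import Algebra.Properties.CommutativeSemigroup *-commutativeSemigroup using (x∙yz≈y∙xz)
    open import Data.List using ([]; _∷_; length)
    open FieldProperties F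
    open Sums F

    eval : Poly F → Carrier → Carrier
    eval []      x = 0#
    eval (a ∷ p) x = a + x * eval p x

    eval-addP : ∀ p q x → eval (addP F p q) x ≈ eval p x + eval q x
    eval-addP []      q       x = sym (+-identityˡ _)
    eval-addP (a ∷ p) []      x = sym (+-identityʳ _)
    eval-addP (a ∷ p) (b ∷ q) x = begin
      (a + b) + x * eval (addP F p q) x       ≈⟨ +-congˡ (*-congˡ (eval-addP p q x)) ⟩
      (a + b) + x * (eval p x + eval q x)     ≈⟨ +-congˡ (distribˡ x _ _) ⟩
      (a + b) + (x * eval p x + x * eval q x) ≈⟨ interchange a b _ _ ⟩
      (a + x * eval p x) + (b + x * eval q x) ∎

    eval-scaleP : ∀ a p x → eval (scaleP F a p) x ≈ a * eval p x
    eval-scaleP a []      x = sym (zeroʳ a)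
    eval-scaleP a (b ∷ p) x = begin
      a * b + x * eval (scaleP F a p) x ≈⟨ +-congˡ (*-congˡ (eval-scaleP a p x)) ⟩
      a * b + x * (a * eval p x)        ≈⟨ +-congˡ (x∙yz≈y∙xz x a _) ⟩
      a * b + a * (x * eval p x)        ≈⟨ distribˡ a _ _ ⟨
      a * (b + x * eval p x)            ∎

    eval-mulXminus : ∀ a p x → eval (mulXminus F a p) x ≈ (x - a) * eval p x
    eval-mulXminus a p x = begin
      eval (addP F (0# ∷ p) (scaleP F (- a) p)) x           ≈⟨ eval-addP (0# ∷ p) (scaleP F (- a) p) x ⟩
      (0# + x * eval p x) + eval (scaleP F (- a) p) x      ≈⟨ +-cong (+-identityˡ _) (eval-scaleP (- a) p x) ⟩
      x * eval p x + - a * eval p x                         ≈⟨ distribʳ _ x (- a) ⟨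
      (x - a) * eval p x                                    ∎

    ∑-coeff : ∀ p N x → length p ≤ N → ∑ N (λ t → coeff F p t * pow F x t) ≈ eval p x
    ∑-coeff []      N       x _ = trans (∑-cong N (λ _ _ → zeroˡ _)) (∑-zero N)
    ∑-coeff (a ∷ p) (suc N) x (s≤s len≤N) = begin
      ∑ (suc N) (λ t → coeff F (a ∷ p) t * pow F x t)   ≈⟨ ∑-unroll N _ ⟩
      a * 1# + ∑ N (λ t → coeff F p t * (x * pow F x t)) ≈⟨ +-cong (*-identityʳ a) (∑-cong N (λ _ _ → x∙yz≈y∙xz _ x _)) ⟩
      a + ∑ N (λ t → x * (coeff F p t * pow F x t))      ≈⟨ +-congˡ (*-distribˡ-∑ N x _) ⟩
      a + x * ∑ N (λ t → coeff F p t * pow F x t)        ≈⟨ +-congˡ (*-congˡ (∑-coeff p N x len≤N)) ⟩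
      a + x * eval p x                                   ∎

    length-addP : ∀ p q → length q ≤ length p → length (addP F p q) ≡ length p
    length-addP []      []      _          = ≡.refl
    length-addP (a ∷ p) []      _          = ≡.refl
    length-addP (a ∷ p) (b ∷ q) (s≤s q≤p)  = ≡.cong suc (length-addP p q q≤p)

    length-scaleP : ∀ a p → length (scaleP F a p) ≡ length p
    length-scaleP a []      = ≡.refl
    length-scaleP a (b ∷ p) = ≡.cong suc (length-scaleP a p)

    length-mulXminus : ∀ a p → length (mulXminus F a p) ≡ suc (length p)
    length-mulXminus a p = length-addP (0# ∷ p) (scaleP F (- a) p)
      (≡.subst (_≤ suc (length p)) (≡.sym (length-scaleP (- a) p)) (ℕ.n≤1+n _))

    length-prodRoots : ∀ w n P → P 0 ≡ false → length (prodRoots F w (suc n) P) ≤ suc n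
    length-prodRoots w zero    P P0 rewrite P0 = ℕ.≤-refl
    length-prodRoots w (suc n) P P0 with P (suc n)
    ... | true  = ≡.subst (_≤ suc (suc n)) (≡.sym (length-mulXminus (pow F w (suc n)) (prodRoots F w (suc n) P)))
                          (s≤s (length-prodRoots w n P P0))
    ... | false = ℕ.m≤n⇒m≤1+n (length-prodRoots w n P P0)

    rootProduct : Carrier → ℕ → (ℕ → Bool) → Carrier → Carrier
    rootProduct w zero    P x = 1#
    rootProduct w (suc n) P x = if P n then (x - pow F w n) * rootProduct w n P x else rootProduct w n P x

    eval-prodRoots : ∀ w n P x → eval (prodRoots F w n P) x ≈ rootProduct w n P x
    eval-prodRoots w zero    P x = trans (+-congˡ (zeroʳ x)) (+-identityʳ 1#)
    eval-prodRoots w (suc n) P x with P n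
    ... | true  = trans (eval-mulXminus (pow F w n) (prodRoots F w n P) x) (*-congˡ (eval-prodRoots w n P x))
    ... | false = eval-prodRoots w n P x

    rootProduct-root : ∀ w n P r x → r < n → P r ≡ true → x ≈ pow F w r → rootProduct w n P x ≈ 0#
    rootProduct-root w (suc n) P r x r<1+n Pr x≈wʳ with r ℕ.≟ n
    ... | yes ≡.refl rewrite Pr = trans (*-congʳ (trans (+-congʳ x≈wʳ) (-‿inverseʳ _))) (zeroˡ _)
    ... | no r≢n with P n
    ...   | true  = trans (*-congˡ (rootProduct-root w n P r x (ℕ.≤∧≢⇒< (ℕ.≤-pred r<1+n) r≢n) Pr x≈wʳ)) (zeroʳ _)
    ...   | false = rootProduct-root w n P r x (ℕ.≤∧≢⇒< (ℕ.≤-pred r<1+n) r≢n) Pr x≈wʳ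

    rootProduct-≉0 : ∀ w n P x → (∀ r → r < n → P r ≡ true → ¬ (x - pow F w r ≈ 0#)) → ¬ (rootProduct w n P x ≈ 0#)
    rootProduct-≉0 w zero    P x _       = 1≉0
    rootProduct-≉0 w (suc n) P x factors with P n in Pn
    ... | true  = *-≉0 (factors n ℕ.≤-refl Pn) (rootProduct-≉0 w n P x (λ r r<n → factors r (ℕ.m<n⇒m<1+n r<n)))
    ... | false = rootProduct-≉0 w n P x (λ r r<n → factors r (ℕ.m<n⇒m<1+n r<n))

  module SubfieldClosure {c ℓ} (F : Field c ℓ) (e : Field.Carrier F) where
    open Field F hiding (zero)
    open Sums F

    ∈-0# : InSubfield F e 0#
    ∈-0# = sf-resp (-‿inverseʳ 1#) (sf-add sf-one (sf-neg sf-one))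

    ∈-ι : ∀ n → InSubfield F e (ι F n)
    ∈-ι zero    = ∈-0#
    ∈-ι (suc n) = sf-add sf-one (∈-ι n)

    ∈-∑ : ∀ n g → (∀ i → i < n → InSubfield F e (g i)) → InSubfield F e (∑ n g)
    ∈-∑ zero    g g∈ = ∈-0#
    ∈-∑ (suc n) g g∈ = sf-add (∈-∑ n g (λ i i<n → g∈ i (ℕ.m<n⇒m<1+n i<n))) (g∈ n ℕ.≤-refl)

    ∈-if : ∀ b {x} → InSubfield F e x → InSubfield F e (if b then x else 0#)
    ∈-if true  x∈ = x∈
    ∈-if false x∈ = ∈-0#

  module Newton {c ℓ} (F : Field c ℓ) (w : Field.Carrier F) (P : ℕ → Bool) where
    open Field F hiding (zero)
    open import Relation.Binary.Reasoning.Setoid setoid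
    open import Algebra.Properties.Ring ring using (-‿+-comm; +-inverseˡ-unique; x[y-z]≈xy-xz; [y-z]x≈yx-zx)
    open import Data.Nat.Induction using (<-rec)
    open import Algebra.Properties.CommutativeSemigroup *-commutativeSemigroup using (x∙yz≈y∙xz)
    open import Algebra.Solver.CommutativeMonoid +-commutativeMonoid using (solve; _⊕_; _⊜_)
    open import Data.Nat using (_∸_)
    open Sums F
    open Powers F
    open Polynomials F using (rootProduct)

    -- elem n t is the coefficient of Tᵗ in ∏_{j < n, P j} (1 - wʲ T)
    elem : ℕ → ℕ → Carrier
    elem zero    zero    = 1#
    elem zero    (suc t) = 0#
    elem (suc n) zero    = elem n zero
    elem (suc n) (suc t) = if P n then elem n (suc t) - pow F w n * elem n t else elem n (suc t)

    powerSum : ℕ → ℕ → Carrier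
    powerSum n i = ∑ n (λ j → if P j then pow F (pow F w j) i else 0#)

    convolution : ℕ → ℕ → (ℕ → Carrier) → Carrier
    convolution n k B = ∑ k (λ j → elem n j * B (k ∸ j))

    newtonSum : ℕ → ℕ → Carrier
    newtonSum n k = ι F k * elem n k + convolution n k (powerSum n)

    elem-skip : ∀ n t → P n ≡ false → elem (suc n) t ≈ elem n t
    elem-skip n zero    Pn = refl
    elem-skip n (suc t) Pn rewrite Pn = refl

    elem-root : ∀ n t → P n ≡ true → elem (suc n) (suc t) ≈ elem n (suc t) - pow F w n * elem n t
    elem-root n t Pn rewrite Pn = refl

    powerSum-skip : ∀ n i → P n ≡ false → powerSum (suc n) i ≈ powerSum n i
    powerSum-skip n i Pn rewrite Pn = +-identityʳ _

    powerSum-root : ∀ n i → P n ≡ true → powerSum (suc n) i ≈ powerSum n i + pow F (pow F w n) i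
    powerSum-root n i Pn rewrite Pn = refl

    convolution-root : ∀ n k B → P n ≡ true →
      convolution (suc n) (suc k) B ≈ convolution n (suc k) B - pow F w n * convolution n k B
    convolution-root n k B Pn = begin
      convolution (suc n) (suc k) B                                        ≈⟨ ∑-unroll k _ ⟩
      elem n 0 * B (suc k) + ∑ k (λ j → elem (suc n) (suc j) * B (k ∸ j))
        ≈⟨ +-congˡ (∑-cong k (λ j _ → trans (*-congʳ (elem-root n j Pn)) ([y-z]x≈yx-zx _ _ _))) ⟩
      elem n 0 * B (suc k) + ∑ k (λ j → elem n (suc j) * B (k ∸ j) - a * elem n j * B (k ∸ j))
        ≈⟨ +-congˡ (∑-distrib-+ k _ _) ⟩
      elem n 0 * B (suc k) + (∑ k (λ j → elem n (suc j) * B (k ∸ j)) + ∑ k (λ j → - (a * elem n j * B (k ∸ j))))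
        ≈⟨ +-assoc _ _ _ ⟨
      (elem n 0 * B (suc k) + ∑ k (λ j → elem n (suc j) * B (k ∸ j))) + ∑ k (λ j → - (a * elem n j * B (k ∸ j)))
        ≈⟨ +-cong (∑-unroll k _) (sym (-‿distrib-∑ k _)) ⟨
      convolution n (suc k) B - ∑ k (λ j → a * elem n j * B (k ∸ j))
        ≈⟨ +-congˡ (-‿cong (trans (∑-cong k (λ j _ → *-assoc a _ _)) (*-distribˡ-∑ k a _))) ⟩
      convolution n (suc k) B - a * convolution n k B                      ∎
      where a = pow F w n

    convolution-new-root : ∀ n k → let a = pow F w n in
      convolution n (suc k) (pow F a) ≈ a * convolution n k (pow F a) + a * elem n k
    convolution-new-root n k = +-cong
      (trans (∑-cong k (λ j j<k → trans (*-congˡ (reflexive (≡.cong (pow F a) (ℕ.+-∸-assoc 1 (ℕ.<⇒≤ j<k)))))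
                                         (x∙yz≈y∙xz _ a _)))
             (*-distribˡ-∑ k a _))
      (trans (*-congˡ (reflexive (≡.cong (pow F a) (ℕ.+-∸-assoc 1 {k} ℕ.≤-refl))))
             (trans (*-congˡ (trans (*-congˡ (reflexive (≡.cong (pow F a) (ℕ.n∸n≡0 k)))) (*-identityʳ a))) (*-comm _ a)))
      where a = pow F w n

    newtonSum-skip : ∀ n k → P n ≡ false → newtonSum (suc n) k ≈ newtonSum n k
    newtonSum-skip n k Pn = +-cong (*-congˡ (elem-skip n k Pn))
      (∑-cong k (λ j _ → *-cong (elem-skip n j Pn) (powerSum-skip n (k ∸ j) Pn)))

    newtonSum-root : ∀ n k → P n ≡ true → newtonSum (suc n) (suc k) ≈ newtonSum n (suc k) - pow F w n * newtonSum n k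
    newtonSum-root n k Pn = begin
      ι F K * elem (suc n) K + convolution (suc n) K (powerSum (suc n))     ≈⟨ +-cong leading tail ⟩
      (ι F K * elem n K - a * u - a * (ι F k * u)) + (C K - a * C k + a * u) ≈⟨ rearrange _ _ _ _ _ ⟩
      (ι F K * elem n K + C K) - (a * (ι F k * u) + a * C k)                ≈⟨ +-congˡ (-‿cong (distribˡ a _ _)) ⟨
      newtonSum n K - a * newtonSum n k                                     ∎
      where
      K = suc k
      a = pow F w n
      u = elem n k
      C = λ m → convolution n m (powerSum n)
      Y = λ m → convolution n m (pow F a)

      leading : ι F K * elem (suc n) K ≈ ι F K * elem n K - a * u - a * (ι F k * u)
      leading = begin
        ι F K * elem (suc n) K                  ≈⟨ *-congˡ (elem-root n k Pn) ⟩
        ι F K * (elem n K - a * u)              ≈⟨ x[y-z]≈xy-xz _ _ _ ⟩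
        ι F K * elem n K - ι F K * (a * u)      ≈⟨ +-congˡ (-‿cong (distribʳ _ 1# (ι F k))) ⟩
        ι F K * elem n K - (1# * (a * u) + ι F k * (a * u))
          ≈⟨ +-congˡ (-‿cong (+-cong (*-identityˡ _) (x∙yz≈y∙xz _ a _))) ⟩
        ι F K * elem n K - (a * u + a * (ι F k * u)) ≈⟨ +-congˡ (-‿+-comm _ _) ⟨
        ι F K * elem n K + (- (a * u) - a * (ι F k * u)) ≈⟨ +-assoc _ _ _ ⟨
        ι F K * elem n K - a * u - a * (ι F k * u) ∎

      tail : convolution (suc n) K (powerSum (suc n)) ≈ C K - a * C k + a * u
      tail = begin
        convolution (suc n) K (powerSum (suc n))
          ≈⟨ ∑-cong K (λ j _ → trans (*-congˡ (powerSum-root n (K ∸ j) Pn)) (distribˡ _ _ _)) ⟩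
        ∑ K (λ j → elem (suc n) j * powerSum n (K ∸ j) + elem (suc n) j * pow F a (K ∸ j))
          ≈⟨ ∑-distrib-+ K _ _ ⟩
        convolution (suc n) K (powerSum n) + convolution (suc n) K (pow F a)
          ≈⟨ +-cong (convolution-root n k (powerSum n) Pn) (convolution-root n k (pow F a) Pn) ⟩
        (C K - a * C k) + (Y K - a * Y k)           ≈⟨ +-congˡ (+-congʳ (convolution-new-root n k)) ⟩
        (C K - a * C k) + ((a * Y k + a * u) - a * Y k)
          ≈⟨ +-congˡ (solve 3 (λ p q r → (p ⊕ q) ⊕ r ⊜ q ⊕ (p ⊕ r)) refl _ _ _) ⟩
        (C K - a * C k) + (a * u + (a * Y k - a * Y k)) ≈⟨ +-congˡ (trans (+-congˡ (-‿inverseʳ _)) (+-identityʳ _)) ⟩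
        C K - a * C k + a * u                        ∎

      rearrange : ∀ A B p q r → (A - p - q) + (B - r + p) ≈ (A + B) - (q + r)
      rearrange A B p q r = begin
        (A - p - q) + (B - r + p)
          ≈⟨ solve 6 (λ A B p q r p′ → ((A ⊕ p′) ⊕ q) ⊕ ((B ⊕ r) ⊕ p) ⊜ (A ⊕ B) ⊕ ((q ⊕ r) ⊕ (p′ ⊕ p)))
                     refl A B p (- q) (- r) (- p) ⟩
        (A + B) + ((- q - r) + (- p + p))          ≈⟨ +-congˡ (+-cong (-‿+-comm q r) (-‿inverseˡ p)) ⟩
        (A + B) + (- (q + r) + 0#)                 ≈⟨ +-congˡ (+-identityʳ _) ⟩
        (A + B) - (q + r)                          ∎

    newton : ∀ n k → newtonSum n k ≈ 0#
    newton zero    zero    = trans (+-identityʳ _) (zeroˡ _)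
    newton zero    (suc k) = trans (+-cong (zeroʳ _) (trans (∑-cong (suc k) (λ _ _ → zeroʳ _)) (∑-zero (suc k)))) (+-identityʳ 0#)
    newton (suc n) zero    = trans (+-identityʳ _) (zeroˡ _)
    newton (suc n) (suc k) = by-cases (P n) ≡.refl
      where
      by-cases : ∀ b → P n ≡ b → newtonSum (suc n) (suc k) ≈ 0#
      by-cases false Pn = trans (newtonSum-skip n (suc k) Pn) (newton n (suc k))
      by-cases true  Pn = begin
        newtonSum (suc n) (suc k)                           ≈⟨ newtonSum-root n k Pn ⟩
        newtonSum n (suc k) - pow F w n * newtonSum n k
          ≈⟨ +-cong (newton n (suc k)) (-‿cong (trans (*-congˡ (newton n k)) (zeroʳ _))) ⟩
        0# - 0#                                             ≈⟨ -‿inverseʳ 0# ⟩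
        0#                                                  ∎

    elem-0 : ∀ n → elem n 0 ≡ 1#
    elem-0 zero    = ≡.refl
    elem-0 (suc n) = elem-0 n

    elem-vanishes : ∀ n t → n < t → elem n t ≈ 0#
    elem-vanishes zero    (suc t) _         = refl
    elem-vanishes (suc n) (suc t) (s≤s n<t) = by-cases (P n) ≡.refl
      where
      by-cases : ∀ b → P n ≡ b → elem (suc n) (suc t) ≈ 0#
      by-cases false Pn = trans (elem-skip n (suc t) Pn) (elem-vanishes n (suc t) (ℕ.m<n⇒m<1+n n<t))
      by-cases true  Pn = begin
        elem (suc n) (suc t)                      ≈⟨ elem-root n t Pn ⟩
        elem n (suc t) - pow F w n * elem n t     ≈⟨ +-cong (elem-vanishes n (suc t) (ℕ.m<n⇒m<1+n n<t))
                                                            (-‿cong (trans (*-congˡ (elem-vanishes n t n<t)) (zeroʳ _))) ⟩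
        0# - 0#                                   ≈⟨ -‿inverseʳ 0# ⟩
        0#                                        ∎

    ∑-elem : ∀ n N → n < N → ∑ N (elem n) ≈ rootProduct w n P 1#
    ∑-elem zero    (suc N) _         = trans (∑-unroll N (elem 0)) (trans (+-congˡ (∑-zero N)) (+-identityʳ 1#))
    ∑-elem (suc n) (suc N) (s≤s n<N) = by-cases (P n) ≡.refl
      where
      a = pow F w n
      X = ∑ N (elem n)
      by-cases : ∀ b → P n ≡ b → ∑ (suc N) (elem (suc n)) ≈ rootProduct w (suc n) P 1#
      by-cases false Pn = begin
        ∑ (suc N) (elem (suc n))       ≈⟨ ∑-cong (suc N) (λ t _ → elem-skip n t Pn) ⟩
        ∑ (suc N) (elem n)             ≈⟨ ∑-elem n (suc N) (ℕ.m<n⇒m<1+n n<N) ⟩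
        rootProduct w n P 1#
          ≡⟨ ≡.cong (λ b → if b then (1# - a) * rootProduct w n P 1# else rootProduct w n P 1#) Pn ⟨
        rootProduct w (suc n) P 1#     ∎
      by-cases true Pn = begin
        ∑ (suc N) (elem (suc n))                                            ≈⟨ ∑-unroll N _ ⟩
        elem n 0 + ∑ N (λ t → elem (suc n) (suc t))
          ≈⟨ +-congˡ (trans (∑-cong N (λ t _ → elem-root n t Pn)) (∑-distrib-+ N _ _)) ⟩
        elem n 0 + (∑ N (λ t → elem n (suc t)) + ∑ N (λ t → - (a * elem n t))) ≈⟨ +-assoc _ _ _ ⟨
        (elem n 0 + ∑ N (λ t → elem n (suc t))) + ∑ N (λ t → - (a * elem n t))
          ≈⟨ +-cong (∑-unroll N (elem n)) (sym (trans (-‿distrib-∑ N _) (-‿cong (*-distribˡ-∑ N a _)))) ⟨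
        ∑ (suc N) (elem n) - a * X              ≈⟨ +-congʳ (trans (+-congˡ (elem-vanishes n N n<N)) (+-identityʳ _)) ⟩
        X - a * X                               ≈⟨ +-congʳ (*-identityˡ X) ⟨
        1# * X - a * X                          ≈⟨ [y-z]x≈yx-zx X 1# a ⟨
        (1# - a) * X                            ≈⟨ *-congˡ (∑-elem n N n<N) ⟩
        (1# - a) * rootProduct w n P 1#
          ≡⟨ ≡.cong (λ b → if b then (1# - a) * rootProduct w n P 1# else rootProduct w n P 1#) Pn ⟨
        rootProduct w (suc n) P 1#              ∎

    -- in characteristic 0, Newton's identities express elem n (k + 1) through lower coefficients and power sums
    elem-∈ : ∀ {e} → (∀ k → ¬ (ι F (suc k) ≈ 0#)) → ∀ n → (∀ i → 0 < i → InSubfield F e (powerSum n i)) →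
             ∀ t → InSubfield F e (elem n t)
    elem-∈ {e} char n powerSum∈ = <-rec (λ t → InSubfield F e (elem n t)) step
      where
      open SubfieldClosure F e
      step : ∀ t → (∀ {j} → j < t → InSubfield F e (elem n j)) → InSubfield F e (elem n t)
      step zero    _  = sf-resp (reflexive (≡.sym (elem-0 n))) sf-one
      step (suc k) ih with inverse (ι F (suc k)) (char k)
      ... | y , ιy≈1 = sf-resp solved (sf-mul (sf-inv (∈-ι (suc k)) ιy≈1) (sf-neg (∈-∑ (suc k) _ (λ j j<K →
                         sf-mul (ih j<K) (powerSum∈ (suc k ∸ j) (ℕ.m<n⇒0<n∸m j<K))))))
        where
        K = suc k
        solved : y * - convolution n K (powerSum n) ≈ elem n K
        solved = begin
          y * - convolution n K (powerSum n) ≈⟨ *-congˡ (+-inverseˡ-unique _ _ (newton n K)) ⟨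
          y * (ι F K * elem n K)             ≈⟨ *-assoc y _ _ ⟨
          (y * ι F K) * elem n K             ≈⟨ *-congʳ (trans (*-comm y _) ιy≈1) ⟩
          1# * elem n K                      ≈⟨ *-identityˡ _ ⟩
          elem n K                           ∎

open import Data.Nat as ℕ using (zero; z≤n; s≤s)
import Data.Nat.Properties as ℕ
open import Data.Nat.DivMod using (_%_; _/_; m%n<n; m%n%n≡m%n; m≡m%n+[m/n]*n)
open import Data.Nat.Divisibility using (divides)
open import Data.Nat.Primality using (prime⇒irreducible)
open import Data.Bool using (true; false; if_then_else_)
open import Data.Fin using (toℕ; fromℕ<)
import Data.Fin.Properties as Fin
open import Data.Product using (Σ; _,_; proj₁; proj₂)
open import Data.Sum using (inj₁; inj₂)
open import Data.Empty using (⊥-elim)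
open import Relation.Nullary using (yes; no)
open import Relation.Binary.PropositionalEquality as ≡ using (_≡_)
open Residues
open FieldTheory

module QuadraticResidueCode
    {c ℓ} (F : Field c ℓ) (char : ∀ n → ¬ (Field._≈_ F (ι F (suc n)) (Field.0# F)))
    (k : ℕ) (l-prime : Prime (suc k)) (m : ℕ) (k≡m+m : k ≡ m ℕ.+ m)
    (z : Field.Carrier F) (zˡ≈1 : Field._≈_ F (pow F z (suc k)) (Field.1# F))
    (z-primitive : ∀ j → 0 < j → j < suc k → ¬ (Field._≈_ F (pow F z j) (Field.1# F)))
    where
  open Field F hiding (zero)
  open import Relation.Binary.Reasoning.Setoid setoid
  open import Algebra.Properties.Ring ring using (+-inverseˡ-unique; +-inverseʳ-unique; x∙y⁻¹≈ε⇒x≈y; -0#≈0#; -1*x≈-x)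
  open import Algebra.Properties.CommutativeMonoid.Sum +-commutativeMonoid using (sum; sum-cong-≋; ∑-comm; sum-replicate-zero)
  open import Algebra.Properties.Semiring.Sum semiring using (*-distribˡ-sum; *-distribʳ-sum)
  open FieldProperties F
  open Sums F
  open Powers F
  open Polynomials F
  open QuadraticResidues k l-prime m k≡m+m
  open SubfieldClosure F (η F l z)
  open Newton F z (inR F l)

  pow-% : ∀ a → pow F z a ≈ pow F z (a % l)
  pow-% a = begin
    pow F z a                                    ≡⟨ ≡.cong (pow F z) (m≡m%n+[m/n]*n a l) ⟩
    pow F z (a % l ℕ.+ a / l ℕ.* l)              ≈⟨ pow-+ z (a % l) _ ⟩
    pow F z (a % l) * pow F z (a / l ℕ.* l)      ≡⟨ ≡.cong (λ e → pow F z (a % l) * pow F z e) (ℕ.*-comm (a / l) l) ⟩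
    pow F z (a % l) * pow F z (l ℕ.* (a / l))    ≈⟨ *-congˡ (pow-* z l (a / l)) ⟩
    pow F z (a % l) * pow F (pow F z l) (a / l)  ≈⟨ *-congˡ (trans (pow-congˡ (a / l) zˡ≈1) (pow-1# (a / l))) ⟩
    pow F z (a % l) * 1#                         ≈⟨ *-identityʳ _ ⟩
    pow F z (a % l)                              ∎

  ∑-powers≈0 : ∑ l (pow F z) ≈ 0#
  ∑-powers≈0 = *-cancel-≉0 z-1≉0 (trans (geometric-sum z l) (trans (+-congʳ zˡ≈1) (-‿inverseʳ 1#)))
    where
    z-1≉0 : ¬ (z - 1# ≈ 0#)
    z-1≉0 z-1≈0 = z-primitive 1 (s≤s z≤n) 1<l (trans (*-identityʳ z) (x∙y⁻¹≈ε⇒x≈y z 1# z-1≈0))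

  1+η+η′≈0 : 1# + (η F l z + η' F l z) ≈ 0#
  1+η+η′≈0 = begin
    1# + (η F l z + η' F l z)          ≈⟨ +-congˡ (∑-distrib-+ l _ _) ⟨
    1# + ∑ l (λ i → R i + R′ i)        ≈⟨ +-congˡ (∑-unroll k _) ⟩
    1# + ((0# + 0#) + ∑ k (λ i → R (suc i) + R′ (suc i)))
      ≈⟨ +-congˡ (trans (+-congʳ (+-identityʳ 0#)) (trans (+-identityˡ _) (∑-cong k (λ i _ → split i)))) ⟩
    1# + ∑ k (λ i → pow F z (suc i))   ≈⟨ ∑-unroll k (pow F z) ⟨
    ∑ l (pow F z)                      ≈⟨ ∑-powers≈0 ⟩
    0#                                 ∎
    where
    R R′ : ℕ → Carrier
    R  i = if inR F l i then pow F z i else 0#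
    R′ i = if inR' F l i then pow F z i else 0#
    split : ∀ i → R (suc i) + R′ (suc i) ≈ pow F z (suc i)
    split i with isQR l (suc i)
    ... | true  = +-identityʳ _
    ... | false = +-identityˡ _

  η′∈L : InSubfield F (η F l z) (η' F l z)
  η′∈L = sf-resp (sym (+-inverseʳ-unique (1# + η F l z) _ (trans (+-assoc _ _ _) 1+η+η′≈0)))
                 (sf-neg (sf-add sf-one sf-gen))

  -- substituting j = v c, with c the inverse of i modulo l, turns the i-th power sum of the
  -- roots z^r (r a residue) into η or η′ according as c is a residue or not
  powerSum-∈ : ∀ i → InSubfield F (η F l z) (powerSum l i)
  powerSum-∈ i with i % l ℕ.≟ 0
  ... | yes i≡0 = ∈-∑ l _ (λ j _ → ∈-if (isQR l j) (sf-resp (sym (zʲⁱ≈1 j)) sf-one))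
    where
    zʲⁱ≈1 : ∀ j → pow F (pow F z j) i ≈ 1#
    zʲⁱ≈1 j = begin
      pow F (pow F z j) i       ≈⟨ pow-* z j i ⟨
      pow F z (j ℕ.* i)         ≈⟨ pow-% (j ℕ.* i) ⟩
      pow F z ((j ℕ.* i) % l)   ≡⟨ ≡.cong (pow F z) (≡.trans (*-cong-% j j i 0 ≡.refl i≡0) (≡.cong (_% l) (ℕ.*-zeroʳ j))) ⟩
      pow F z 0                 ∎
  ... | no i≢0 with inverse-% (i % l) (λ i%l≡0 → i≢0 (≡.trans (≡.sym (m%n%n≡m%n i l)) i%l≡0))
  ...   | c , c<l , κc≡1 = sf-resp (sym reindexed) (by-cases (isQR l c) ≡.refl)
    where
    κ = i % l
    cκ≡1 : (c ℕ.* κ) % l ≡ 1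
    cκ≡1 = ≡.trans (≡.cong (_% l) (ℕ.*-comm c κ)) κc≡1

    g : ℕ → Carrier
    g j = if isQR l j then pow F (pow F z j) i else 0#

    reindexed : powerSum l i ≈ ∑ l (λ v → if isQR l (v ℕ.* c) then pow F z v else 0#)
    reindexed = begin
      ∑ l g                                ≈⟨ ∑-permute l (λ v → (v ℕ.* c) % l) (λ j → (j ℕ.* κ) % l) g
                                                 (λ v _ → m%n<n (v ℕ.* c) l) (λ j _ → m%n<n (j ℕ.* κ) l)
                                                 (λ j → *-inverse-%-cancel κ c j κc≡1) (λ v → *-inverse-%-cancel c κ v cκ≡1) ⟨
      ∑ l (λ v → g ((v ℕ.* c) % l))        ≈⟨ ∑-cong l (λ v v<l → if-cong (isQR-% (v ℕ.* c)) (power v v<l)) ⟩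
      ∑ l (λ v → if isQR l (v ℕ.* c) then pow F z v else 0#) ∎
      where
      power : ∀ v → v < l → pow F (pow F z ((v ℕ.* c) % l)) i ≈ pow F z v
      power v v<l = begin
        pow F (pow F z w) i      ≈⟨ pow-* z w i ⟨
        pow F z (w ℕ.* i)        ≈⟨ pow-% (w ℕ.* i) ⟩
        pow F z ((w ℕ.* i) % l)  ≡⟨ ≡.cong (pow F z) w*i≡v ⟩
        pow F z v                ∎
        where
        w = (v ℕ.* c) % l
        w*i≡v : (w ℕ.* i) % l ≡ v
        w*i≡v = ≡.trans (*-cong-% w w i κ ≡.refl (≡.sym (m%n%n≡m%n i l))) (*-inverse-%-cancel c κ v cκ≡1 v<l)

    by-cases : ∀ b → isQR l c ≡ b → InSubfield F (η F l z) (∑ l (λ v → if isQR l (v ℕ.* c) then pow F z v else 0#))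
    by-cases true  qc = sf-resp (∑-cong l (λ v _ → if-cong (≡.sym (isQR-*-res c qc v)) refl)) sf-gen
    by-cases false qc = sf-resp (∑-cong l (λ v v<l → if-cong (≡.sym (isQR-*-nonres c (unit-≢0 c κ cκ≡1) qc v v<l)) refl)) η′∈L

  f : Poly F
  f = fPoly F l z

  f-at : ∀ x → ∑ l (λ t → coeff F f t * pow F x t) ≈ rootProduct z l (inR F l) x
  f-at x = trans (∑-coeff f l x (length-prodRoots z k (inR F l) ≡.refl)) (eval-prodRoots z l (inR F l) x)

  f-root : ∑ l (λ t → coeff F f t * pow F z t) ≈ 0#
  f-root = trans (f-at z) (rootProduct-root z l (inR F l) 1 z 1<l isQR-1 (sym (*-identityʳ z)))

  f1 : Carrier
  f1 = ∑ l (coeff F f)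

  f1≈ : f1 ≈ rootProduct z l (inR F l) 1#
  f1≈ = trans (∑-cong l (λ t _ → trans (sym (*-identityʳ _)) (*-congˡ (sym (pow-1# t))))) (f-at 1#)

  f1∈L : InSubfield F (η F l z) f1
  f1∈L = sf-resp (trans (∑-elem l (suc l) ℕ.≤-refl) (sym f1≈))
                 (∈-∑ (suc l) (elem l) (λ t _ → elem-∈ char l (λ i _ → powerSum-∈ i) t))

  f1≉0 : ¬ (f1 ≈ 0#)
  f1≉0 f1≈0 = rootProduct-≉0 z l (inR F l) 1# factor≉0 (trans (sym f1≈) f1≈0)
    where
    factor≉0 : ∀ r → r < l → inR F l r ≡ true → ¬ (1# - pow F z r ≈ 0#)
    factor≉0 (suc r) r<l _ 1-zʳ≈0 = z-primitive (suc r) (s≤s z≤n) r<l (sym (x∙y⁻¹≈ε⇒x≈y _ _ 1-zʳ≈0))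

  -- f(z) = 0 and zˡ = 1, so each cyclic shift of f, read as a word, vanishes at z too
  shifted-f-root : ∀ j → j < l → ∑ l (λ n → coeff F f ((l ℕ.+ n ∸ j) % l) * pow F z n) ≈ 0#
  shifted-f-root j j<l = begin
    ∑ l (λ n → coeff F f ((l ℕ.+ n ∸ j) % l) * pow F z n)  ≈⟨ ∑-cong l (λ n n<l → reflexive (shift n n<l)) ⟩
    ∑ l (λ n → G (p n))                                    ≈⟨ ∑-permute l p p′ G (λ n _ → m%n<n (n ℕ.+ (l ∸ j)) l) (λ t _ → m%n<n (t ℕ.+ j) l)
                                                                (λ t t<l → shift-%-inverse j (l ∸ j) t (ℕ.m+[n∸m]≡n (ℕ.<⇒≤ j<l)) t<l)
                                                                (λ n n<l → shift-%-inverse (l ∸ j) j n (ℕ.m∸n+n≡m (ℕ.<⇒≤ j<l)) n<l) ⟩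
    ∑ l G
      ≈⟨ ∑-cong l (λ t _ → *-congˡ (trans (sym (pow-% (t ℕ.+ j))) (pow-+ z t j))) ⟩
    ∑ l (λ t → coeff F f t * (pow F z t * pow F z j))      ≈⟨ ∑-cong l (λ t _ → trans (sym (*-assoc _ _ _)) (*-comm _ _)) ⟩
    ∑ l (λ t → pow F z j * (coeff F f t * pow F z t))      ≈⟨ *-distribˡ-∑ l (pow F z j) _ ⟩
    pow F z j * ∑ l (λ t → coeff F f t * pow F z t)        ≈⟨ *-congˡ f-root ⟩
    pow F z j * 0#                                         ≈⟨ zeroʳ _ ⟩
    0#                                                     ∎
    where
    p p′ : ℕ → ℕ
    p n = (n ℕ.+ (l ∸ j)) % l
    p′ t = (t ℕ.+ j) % l
    G : ℕ → Carrier
    G t = coeff F f t * pow F z (p′ t)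
    shift : ∀ n → n < l → coeff F f ((l ℕ.+ n ∸ j) % l) * pow F z n ≡ G (p n)
    shift n n<l = ≡.cong₂ (λ u v → coeff F f u * pow F z v)
      (≡.cong (_% l) (≡.trans (≡.cong (_∸ j) (ℕ.+-comm l n)) (ℕ.+-∸-assoc n (ℕ.<⇒≤ j<l))))
      (≡.sym (shift-%-inverse (l ∸ j) j n (ℕ.m∸n+n≡m (ℕ.<⇒≤ j<l)) n<l))

  codeword-root : ∀ a → InAplus F l z a → sumFin F l (λ i → a i * pow F z (toℕ i)) ≈ 0#
  codeword-root a (_ , h , _ , a≈hf) = begin
    sumFin F l (λ i → a i * zⁱ i)                        ≡⟨ sumFin≡sum l {λ i → a i * zⁱ i} ⟩
    sum (λ i → a i * zⁱ i)
      ≈⟨ sum-cong-≋ (λ i → *-congʳ {zⁱ i} (trans (a≈hf i) (reflexive (sumFin≡sum l {λ j → h j * fᵢⱼ i j})))) ⟩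
    sum (λ i → sum (λ j → h j * fᵢⱼ i j) * zⁱ i)         ≈⟨ sum-cong-≋ (λ i → *-distribʳ-sum (zⁱ i) (λ j → h j * fᵢⱼ i j)) ⟩
    sum (λ i → sum (λ j → h j * fᵢⱼ i j * zⁱ i))         ≈⟨ ∑-comm (λ i j → h j * fᵢⱼ i j * zⁱ i) ⟩
    sum (λ j → sum (λ i → h j * fᵢⱼ i j * zⁱ i))
      ≈⟨ sum-cong-≋ (λ j → trans (sum-cong-≋ (λ i → *-assoc (h j) (fᵢⱼ i j) (zⁱ i))) (sym (*-distribˡ-sum (h j) (λ i → fᵢⱼ i j * zⁱ i)))) ⟩
    sum (λ j → h j * sum (λ i → fᵢⱼ i j * zⁱ i))
      ≈⟨ sum-cong-≋ (λ j → trans (*-congˡ {h j} (trans (sum≈∑ l _) (shifted-f-root (toℕ j) (Fin.toℕ<n j)))) (zeroʳ _)) ⟩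
    sum {l} (λ _ → 0#)                                   ≈⟨ sum-replicate-zero l ⟩
    0#                                                   ∎
    where
    zⁱ : Fin l → Carrier
    zⁱ i = pow F z (toℕ i)
    fᵢⱼ : Fin l → Fin l → Carrier
    fᵢⱼ i j = coeff F f (subMod F l i j)

  f1⁻¹ : Carrier
  f1⁻¹ = proj₁ (inverse f1 f1≉0)

  f1*f1⁻¹≈1 : f1 * f1⁻¹ ≈ 1#
  f1*f1⁻¹≈1 = proj₂ (inverse f1 f1≉0)

  ones : Fin l → Carrier
  ones _ = 1#

  ones∈A⁺ : InAplus F l z ones
  ones∈A⁺ = (λ _ → sf-one) , (λ _ → f1⁻¹) , (λ _ → sf-inv f1∈L f1*f1⁻¹≈1) , λ i → sym (begin
    sumFin F l (λ j → f1⁻¹ * coeff F f (subMod F l i j))  ≈⟨ sumFin≈∑ l _ (λ j → f1⁻¹ * coeff F f (ρ i j)) (λ _ → refl) ⟩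
    ∑ l (λ j → f1⁻¹ * coeff F f (ρ i j))                  ≈⟨ *-distribˡ-∑ l f1⁻¹ _ ⟩
    f1⁻¹ * ∑ l (λ j → coeff F f (ρ i j))
      ≈⟨ *-congˡ (∑-permute l (ρ i) (ρ i) (coeff F f) (ρ<l i) (ρ<l i) (ρ-involutive i) (ρ-involutive i)) ⟩
    f1⁻¹ * f1                                             ≈⟨ trans (*-comm _ _) f1*f1⁻¹≈1 ⟩
    1#                                                    ∎)
    where
    ρ : Fin l → ℕ → ℕ
    ρ i j = (l ℕ.+ toℕ i ∸ j) % l
    ρ<l : ∀ i j → j < l → ρ i j < l
    ρ<l i j _ = m%n<n (l ℕ.+ toℕ i ∸ j) l
    ρ-involutive : ∀ i j → j < l → ρ i (ρ i j) ≡ j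
    ρ-involutive i = reflect-%-involutive (toℕ i)

  σ-coordinate : (Fin l → Carrier) → Carrier → ℕ → Carrier
  σ-coordinate a a∞ zero    = a∞
  σ-coordinate a a∞ (suc n) = legendre F l (suc n) * a (fromℕ< (m%n<n (negInv l (suc n)) l))

  σ-coordinates : ∀ a a∞ i → proj₁ (σ F l (a , a∞)) i ≡ σ-coordinate a a∞ (toℕ i)
  σ-coordinates a a∞ i with toℕ i
  ... | zero  = ≡.refl
  ... | suc n = ≡.refl

  σ-ones-at-z : ∀ a∞ → sumFin F l (λ i → proj₁ (σ F l (ones , a∞)) i * pow F z (toℕ i)) ≈ a∞ + (η F l z - η' F l z)
  σ-ones-at-z a∞ = begin
    sumFin F l (λ i → proj₁ (σ F l (ones , a∞)) i * pow F z (toℕ i))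
      ≈⟨ sumFin≈∑ l _ (λ n → σ-coordinate ones a∞ n * pow F z n) (λ i → *-congʳ (reflexive (σ-coordinates ones a∞ i))) ⟩
    ∑ l (λ n → σ-coordinate ones a∞ n * pow F z n)                         ≈⟨ ∑-unroll k _ ⟩
    a∞ * 1# + ∑ k (λ n → legendre F l (suc n) * 1# * pow F z (suc n))
      ≈⟨ +-cong (*-identityʳ a∞) (∑-cong k (λ n _ → by-legendre n)) ⟩
    a∞ + ∑ k (λ n → D (suc n))
      ≈⟨ +-congˡ (trans (+-congʳ (-‿inverseʳ 0#)) (+-identityˡ _)) ⟨
    a∞ + ((0# - 0#) + ∑ k (λ n → D (suc n)))                               ≈⟨ +-congˡ (∑-unroll k D) ⟨
    a∞ + ∑ l D
      ≈⟨ +-congˡ (trans (∑-distrib-+ l _ _) (+-congˡ (-‿distrib-∑ l _))) ⟩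
    a∞ + (η F l z - η' F l z)                                              ∎
    where
    D : ℕ → Carrier
    D n = (if inR F l n then pow F z n else 0#) - (if inR' F l n then pow F z n else 0#)
    by-legendre : ∀ n → legendre F l (suc n) * 1# * pow F z (suc n) ≈ D (suc n)
    by-legendre n with isQR l (suc n)
    ... | true  = trans (*-congʳ (*-identityʳ 1#)) (trans (*-identityˡ _) (sym (trans (+-congˡ -0#≈0#) (+-identityʳ _))))
    ... | false = trans (*-congʳ (*-identityʳ (- 1#))) (trans (-1*x≈-x _) (sym (+-identityˡ _)))

  sumFin-ones : ∀ n → sumFin F n (λ _ → 1#) ≡ ι F n
  sumFin-ones zero    = ≡.refl
  sumFin-ones (suc n) = ≡.cong (1# +_) (sumFin-ones n)

  σ-closed⇒lγ≈ : ∀ γ → (∀ w → InAinf F l z γ w → InAinf F l z γ (σ F l w)) → ι F l * γ ≈ - (η F l z + - η' F l z)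
  σ-closed⇒lγ≈ γ closed = +-inverseˡ-unique _ _ (begin
    ι F l * γ + (η F l z - η' F l z)
      ≈⟨ +-congʳ (trans (*-comm _ γ) (*-congˡ (reflexive (≡.sym (sumFin-ones l))))) ⟩
    a∞ + (η F l z - η' F l z)                    ≈⟨ σ-ones-at-z a∞ ⟨
    sumFin F l (λ i → proj₁ (σ F l (ones , a∞)) i * pow F z (toℕ i))
      ≈⟨ codeword-root _ (proj₁ (closed (ones , a∞) (ones∈A⁺ , refl))) ⟩
    0#                                           ∎)
    where a∞ = γ * sumFin F l ones

odd-prime-half : ∀ k → Prime (suc k) → suc k ≢ 2 → Σ ℕ λ m → k ≡ m ℕ.+ m
odd-prime-half k l-prime l≢2 with k % 2 | m≡m%n+[m/n]*n k 2 | m%n<n k 2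
... | 0           | k≡ | _ = k / 2 , ≡.trans k≡ (≡.trans (ℕ.*-comm (k / 2) 2) (≡.cong (k / 2 ℕ.+_) (ℕ.+-identityʳ (k / 2))))
... | suc (suc _) | _  | s≤s (s≤s ())
... | 1           | k≡ | _ with prime⇒irreducible l-prime (divides (suc (k / 2)) (≡.cong suc k≡))
...   | inj₁ ()
...   | inj₂ 2≡l = ⊥-elim (l≢2 (≡.sym 2≡l))

mainTheorem2 : ∀ {c ℓ′ : Level} (F : Field c ℓ′) →
    let open Field F in
    (∀ n → ¬ (ι F (suc n) ≈ 0#)) →
    (l : ℕ) → .{{_ : NonZero l}} → Prime l → l ≢ 2 →
    (z : Carrier) → pow F z l ≈ 1# → (∀ k → 0 < k → k < l → ¬ (pow F z k ≈ 1#)) →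
    (γ : Carrier) → InSubfield F (η F l z) γ →
    ι F l * (γ * γ) ≈ legendre F l (l ∸ 1) →
    (∀ (w : (Fin l → Carrier) × Carrier) →
       InAinf F l z γ w → InAinf F l z γ (σ F l w)) →
    ι F l * γ ≈ - (η F l z + - η' F l z)
mainTheorem2 F char (suc k) l-prime l≢2 z zˡ≈1 z-primitive γ _ _ σ-closed with odd-prime-half k l-prime l≢2
... | m , k≡m+m = QuadraticResidueCode.σ-closed⇒lγ≈ F char k l-prime m k≡m+m z zˡ≈1 z-primitive γ σ-closed
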